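{- Let $G$ be a $(2K_2, K_1+P_4)$-free graph. Then $\chi(G) \leq \omega(G)+2$.
   Context: All graphs are finite, simple and undirected. $P_n$ is the path on $n$ vertices, $K_n$ the complete graph on $n$ vertices; $2K_2$ is the disjoint union of two copies of $K_2$; $G_1+G_2$ denotes the join of $G_1$ and $G_2$ (disjoint union plus all edges between them), so $K_1+P_4$ is $P_4$ together with a vertex adjacent to all its vertices. A graph is $\mathcal{F}$-free if it has no induced subgraph isomorphic to a member of $\mathcal{F}$. $\chi(G)$ is the chromatic number and $\omega(G)$ the clique number of $G$. -}

module Defs where

open import Data.Nat using (ℕ; zero; suc; _+_)
open import Data.Fin using (Fin; zero; suc)
open import Data.Bool using (Bool; true; false; _∨_)
open import Data.Product using (Σ; _×_; ∃-syntax)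
open import Relation.Binary.PropositionalEquality using (_≡_; _≢_)
open import Relation.Nullary using (¬_)
open import Function.Definitions using (Injective)

record Graph (n : ℕ) : Set where
  field
    adj   : Fin n → Fin n → Bool
    sym   : ∀ i j → adj i j ≡ adj j i
    irrefl : ∀ i → adj i i ≡ false
open Graph public

InducedCopy : ∀ {m n} → Graph m → Graph n → Set
InducedCopy {m} {n} H G =
  Σ (Fin m → Fin n) λ f → Injective _≡_ _≡_ f × (∀ i j → adj G (f i) (f j) ≡ adj H i j)

Free : ∀ {m n} → Graph m → Graph n → Set
Free H G = ¬ InducedCopy H G

Clique : ∀ {n} → Graph n → ℕ → Set
Clique {n} G k =
  Σ (Fin k → Fin n) λ f → Injective _≡_ _≡_ f × (∀ i j → i ≢ j → adj G (f i) (f j) ≡ true)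

IsCliqueNumber : ∀ {n} → Graph n → ℕ → Set
IsCliqueNumber G w = Clique G w × ¬ Clique G (suc w)

ProperColouring : ∀ {n} → Graph n → ℕ → Set
ProperColouring {n} G k =
  Σ (Fin n → Fin k) λ c → ∀ i j → adj G i j ≡ true → c i ≢ c j

-- χ(G) ≤ k  iff  G has a proper k-colouring.
Colourable : ∀ {n} → Graph n → ℕ → Set
Colourable G k = ProperColouring G k

fromEdges : ∀ {n} (e : Fin n → Fin n → Bool) → (∀ i → e i i ≡ false) → Graph n
fromEdges e irr = record
  { adj = λ i j → e i j ∨ e j i
  ; sym = λ i j → ∨-comm' (e i j) (e j i)
  ; irrefl = λ i → lemma (e i i) (irr i)
  }
  where
  open import Relation.Binary.PropositionalEquality using (refl)
  ∨-comm' : ∀ a b → (a ∨ b) ≡ (b ∨ a)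
  ∨-comm' false false = refl
  ∨-comm' false true = refl
  ∨-comm' true false = refl
  ∨-comm' true true = refl
  lemma : ∀ a → a ≡ false → (a ∨ a) ≡ false
  lemma .false refl = refl

e2K2 : Fin 4 → Fin 4 → Bool
e2K2 zero (suc zero) = true
e2K2 (suc (suc zero)) (suc (suc (suc zero))) = true
e2K2 _ _ = false

eK1P4 : Fin 5 → Fin 5 → Bool
eK1P4 zero (suc _) = true
eK1P4 (suc zero) (suc (suc zero)) = true
eK1P4 (suc (suc zero)) (suc (suc (suc zero))) = true
eK1P4 (suc (suc (suc zero))) (suc (suc (suc (suc zero)))) = true
eK1P4 _ _ = false

twoK2 : Graph 4
twoK2 = fromEdges e2K2 irr
  where
  open import Relation.Binary.PropositionalEquality using (refl)
  irr : ∀ i → e2K2 i i ≡ false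
  irr zero = refl
  irr (suc zero) = refl
  irr (suc (suc zero)) = refl
  irr (suc (suc (suc zero))) = refl

K1+P4 : Graph 5
K1+P4 = fromEdges eK1P4 irr
  where
  open import Relation.Binary.PropositionalEquality using (refl)
  irr : ∀ i → eK1P4 i i ≡ false
  irr zero = refl
  irr (suc zero) = refl
  irr (suc (suc zero)) = refl
  irr (suc (suc (suc zero))) = refl
  irr (suc (suc (suc (suc zero)))) = refl

-- Let v be a vertex of maximum degree. A P4 in N(v) would form a K1+P4 with v, so N(v) is
-- P4-free. In a 2K2-free graph, if u has maximum degree within a P4-free vertex set S, its
-- non-neighbours in S are independent; peeling them off as one colour class and recursing
-- into N(u) ∩ S colours N(v) with ω colours. Whenever a non-neighbour x of v has a neighbour
-- y outside N(v), maximality of deg v yields u ∈ N(v) missing x; playing such vertices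
-- against 2K2 and K1+P4 shows that the non-neighbours of v span neither a triangle nor an
-- induced C5. Being also 2K2-free, they induce a bipartite graph, which takes two further
-- colours.

module Submission where

open import Defs
open import Level using (0ℓ)
open import Function using (_∘_)
open import Data.Empty using (⊥; ⊥-elim)
open import Data.Sum using (_⊎_; inj₁; inj₂)
open import Data.Product using (Σ; _×_; _,_; proj₁; proj₂; ∃-syntax)
open import Data.Bool using (true; false)
import Data.Bool.Properties as Bool
open import Data.Nat using (ℕ; zero; suc; _+_; _≤_; _<_; z≤n; s≤s)
open import Data.Nat.Properties
  using (<-≤-trans; m≤m+n; +-monoʳ-<; +-cancelˡ-≡; <⇒≢; <⇒≱; ≤-reflexive; +-comm)
open import Data.Fin as Fin using (Fin; zero; suc; toℕ; fromℕ<)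
open import Data.Fin.Properties using (all?; any?; <-cmp; toℕ-fromℕ<)
open import Data.Fin.Subset using (Subset; _∈_; _∉_; _⊆_; _∩_; ⊤; ∣_∣; Nonempty)
open import Data.Fin.Subset.Properties
  using (_∈?_; nonempty?; ∈⊤; x∈p∩q⁺; x∈p∩q⁻; p⊂q⇒∣p∣<∣q∣)
open import Data.Vec using ([]; _∷_; lookup; tabulate)
open import Data.Vec.Properties using (lookup∘tabulate; []=⇒lookup; lookup⇒[]=)
open import Data.List using (List; filter; allFin)
open import Data.List.Extrema.Nat using (argmax; argmax-all; f[xs]≤f[argmax])
import Data.List.Relation.Unary.All as All
open import Data.List.Relation.Unary.All.Properties using (all-filter)
open import Data.List.Membership.Propositional.Properties using (∈-filter⁺; ∈-allFin)
open import Relation.Unary using (Pred; Decidable; U)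
open import Relation.Binary.Definitions using (tri<; tri≈; tri>)
open import Relation.Binary.PropositionalEquality as ≡ using (_≡_; _≢_; refl)
open import Relation.Nullary using (¬_; Dec; yes; no; contradiction)
open import Relation.Nullary.Decidable using (from-yes; decidable-stable; _×-dec_; _→-dec_; ¬?)
open import Function.Definitions using (Injective)

PointDetermining : ∀ {m} → Graph m → Set
PointDetermining H = ∀ i j → (∀ k → adj H i k ≡ adj H j k) → i ≡ j

point-determining? : ∀ {m} (H : Graph m) → Dec (PointDetermining H)
point-determining? H =
  all? λ i → all? λ j → all? (λ k → adj H i k Bool.≟ adj H j k) →-dec i Fin.≟ j

twoK2-point-determining : PointDetermining twoK2
twoK2-point-determining = from-yes (point-determining? twoK2)

K1+P4-point-determining : PointDetermining K1+P4
K1+P4-point-determining = from-yes (point-determining? K1+P4)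

module _ {m n} {H : Graph m} {G : Graph n} (f : Fin m → Fin n) where

  adjacency-from-upper : (∀ {i j} → i Fin.< j → adj G (f i) (f j) ≡ adj H i j) →
                         ∀ i j → adj G (f i) (f j) ≡ adj H i j
  adjacency-from-upper upper i j with <-cmp i j
  ... | tri< i<j _ _ = upper i<j
  ... | tri≈ _ refl _ = ≡.trans (irrefl G (f i)) (≡.sym (irrefl H i))
  ... | tri> _ _ j<i = ≡.trans (sym G (f i) (f j)) (≡.trans (upper j<i) (sym H j i))

  -- Equal images have equal rows in G, hence equal rows in H.
  induced-copy : PointDetermining H →
                 (∀ {i j} → i Fin.< j → adj G (f i) (f j) ≡ adj H i j) → InducedCopy H G
  induced-copy point-determining upper = f , injective , f-adj
    where
    f-adj : ∀ i j → adj G (f i) (f j) ≡ adj H i j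
    f-adj = adjacency-from-upper upper
    injective : Injective _≡_ _≡_ f
    injective {i} {j} fi≡fj = point-determining i j λ k →
      ≡.trans (≡.sym (f-adj i k)) (≡.trans (≡.cong (λ x → adj G x (f k)) fi≡fj) (f-adj j k))

module _ {n} (G : Graph n) where

  infix 4 _~_ _≁_

  _~_ _≁_ : Fin n → Fin n → Set
  x ~ y = adj G x y ≡ true
  x ≁ y = adj G x y ≡ false

  private variable
    k l : ℕ
    a b c d h p q r s u v w x y z : Fin n
    c0 c1 c2 c3 c4 : Fin n
    A B P Q : Pred (Fin n) 0ℓ
    S : Subset n

  ~-sym : x ~ y → y ~ x
  ~-sym {x} {y} = ≡.trans (sym G y x)

  ≁-sym : x ≁ y → y ≁ x
  ≁-sym {x} {y} = ≡.trans (sym G y x)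

  ≁⇒¬~ : x ≁ y → ¬ x ~ y
  ≁⇒¬~ x≁y x~y = contradiction (≡.trans (≡.sym x~y) x≁y) λ ()

  ¬~⇒≁ : ¬ x ~ y → x ≁ y
  ¬~⇒≁ = Bool.¬-not

  ~-irrefl : x ~ y → x ≢ y
  ~-irrefl {x} x~y refl = ≁⇒¬~ (irrefl G x) x~y

  ~-or-≁ : ∀ x y → x ~ y ⊎ x ≁ y
  ~-or-≁ x y with adj G x y
  ... | true  = inj₁ refl
  ... | false = inj₂ refl

  N : Fin n → Subset n
  N x = tabulate (adj G x)

  ∈N⁺ : x ~ y → y ∈ N x
  ∈N⁺ {x} {y} x~y = lookup⇒[]= y (N x) (≡.trans (lookup∘tabulate (adj G x) y) x~y)

  ∈N⁻ : y ∈ N x → x ~ y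
  ∈N⁻ {y} {x} y∈Nx = ≡.trans (≡.sym (lookup∘tabulate (adj G x) y)) ([]=⇒lookup y∈Nx)

  ∉N⇒≁ : y ∉ N x → x ≁ y
  ∉N⇒≁ y∉Nx = ¬~⇒≁ (y∉Nx ∘ ∈N⁺)

  record InducedP4 (a b c d : Fin n) : Set where
    constructor induced-P4
    field
      ab : a ~ b
      bc : b ~ c
      cd : c ~ d
      ac : a ≁ c
      ad : a ≁ d
      bd : b ≁ d

  P4FreeOn : Pred (Fin n) 0ℓ → Set
  P4FreeOn P = ∀ {a b c d} → P a → P b → P c → P d → InducedP4 a b c d → ⊥

  record InducedC5 (c0 c1 c2 c3 c4 : Fin n) : Set where
    constructor induced-C5
    field
      e01 : c0 ~ c1
      e12 : c1 ~ c2
      e23 : c2 ~ c3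
      e34 : c3 ~ c4
      e40 : c4 ~ c0
      n02 : c0 ≁ c2
      n03 : c0 ≁ c3
      n13 : c1 ≁ c3
      n14 : c1 ≁ c4
      n24 : c2 ≁ c4

  rotate : InducedC5 c0 c1 c2 c3 c4 → InducedC5 c1 c2 c3 c4 c0
  rotate C = record
    { e01 = e12 ; e12 = e23 ; e23 = e34 ; e34 = e40 ; e40 = e01
    ; n02 = n13 ; n03 = n14 ; n13 = n24 ; n14 = ≁-sym n02 ; n24 = ≁-sym n03 }
    where open InducedC5 C

  TriangleFreeOn : Pred (Fin n) 0ℓ → Set
  TriangleFreeOn M = ∀ {x y z} → M x → M y → M z → x ~ y → y ~ z → x ~ z → ⊥

  C5FreeOn : Pred (Fin n) 0ℓ → Set
  C5FreeOn M = ∀ {c0 c1 c2 c3 c4} → M c0 → M c1 → M c2 → M c3 → M c4 →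
               InducedC5 c0 c1 c2 c3 c4 → ⊥

  CliqueIn : Pred (Fin n) 0ℓ → ℕ → Set
  CliqueIn P k = Σ (Fin k → Fin n) λ f → (∀ {i j} → i ≢ j → f i ~ f j) × (∀ i → P (f i))

  clique-singleton : P x → CliqueIn P 1
  clique-singleton {x = x} px =
    (λ _ → x) , (λ { {zero} {zero} 0≢0 → ⊥-elim (0≢0 refl) }) , λ _ → px

  clique-cons : P v → (∀ {x} → Q x → P x × v ~ x) → CliqueIn Q k → CliqueIn P (suc k)
  clique-cons {P = P} {v = v} {k = k} pv Q⇒P∩Nv (f , f~ , qf) = g , g~ , pg
    where
    g : Fin (suc k) → Fin n
    g zero    = v
    g (suc i) = f i
    g~ : ∀ {i j} → i ≢ j → g i ~ g j
    g~ {zero}  {zero}  0≢0 = ⊥-elim (0≢0 refl)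
    g~ {zero}  {suc j} _   = proj₂ (Q⇒P∩Nv (qf j))
    g~ {suc i} {zero}  _   = ~-sym (proj₂ (Q⇒P∩Nv (qf i)))
    g~ {suc i} {suc j} i≢j = f~ (i≢j ∘ ≡.cong suc)
    pg : ∀ i → P (g i)
    pg zero    = pv
    pg (suc i) = proj₁ (Q⇒P∩Nv (qf i))

  clique : CliqueIn P k → Clique G k
  clique (f , f~ , _) = f , injective , λ i j → f~
    where
    injective : Injective _≡_ _≡_ f
    injective {i} {j} fi≡fj with i Fin.≟ j
    ... | yes i≡j = i≡j
    ... | no  i≢j = contradiction fi≡fj (~-irrefl (f~ i≢j))

  record Colouring (P : Pred (Fin n) 0ℓ) (k : ℕ) : Set where
    field
      colour   : Fin n → ℕ
      colour<k : ∀ {x} → P x → colour x < k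
      proper   : ∀ {x y} → P x → P y → x ~ y → colour x ≢ colour y

  empty-colouring : (∀ {x} → ¬ P x) → Colouring P k
  empty-colouring empty = record
    { colour = λ _ → 0 ; colour<k = ⊥-elim ∘ empty ; proper = λ px → ⊥-elim (empty px) }

  independent-colouring : (∀ {x y} → P x → P y → ¬ x ~ y) → Colouring P (suc k)
  independent-colouring independent = record
    { colour   = λ _ → 0
    ; colour<k = λ _ → s≤s z≤n
    ; proper   = λ px py x~y _ → independent px py x~y }

  colouring-mono : k ≤ l → Colouring P k → Colouring P l
  colouring-mono k≤l C = record
    { colour = colour ; colour<k = λ px → <-≤-trans (colour<k px) k≤l ; proper = proper }
    where open Colouring C

  colouring-∪ : Decidable A → Colouring A k → Colouring B l →
                (∀ {x} → P x → ¬ A x → B x) → Colouring P (k + l)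
  colouring-∪ {A} {k} {B} {l} {P} A? CA CB cover = record
    { colour = colour ; colour<k = colour<k ; proper = proper }
    where
    module CA = Colouring CA
    module CB = Colouring CB
    colour : Fin n → ℕ
    colour x with A? x
    ... | yes _ = CA.colour x
    ... | no  _ = k + CB.colour x
    below : ∀ {x} → A x → ∀ c → CA.colour x < k + c
    below ax c = <-≤-trans (CA.colour<k ax) (m≤m+n k c)
    colour<k : ∀ {x} → P x → colour x < k + l
    colour<k {x} px with A? x
    ... | yes ax  = below ax l
    ... | no  ¬ax = +-monoʳ-< k (CB.colour<k (cover px ¬ax))
    proper : ∀ {x y} → P x → P y → x ~ y → colour x ≢ colour y
    proper {x} {y} px py x~y with A? x | A? y
    ... | yes ax  | yes ay  = CA.proper ax ay x~y
    ... | yes ax  | no  _   = <⇒≢ (below ax _)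
    ... | no  _   | yes ay  = <⇒≢ (below ay _) ∘ ≡.sym
    ... | no  ¬ax | no  ¬ay = CB.proper (cover px ¬ax) (cover py ¬ay) x~y ∘ +-cancelˡ-≡ k _ _

  colourable : Colouring U k → Colourable G k
  colourable C = (λ x → fromℕ< (colour<k {x} _)) , λ x y x~y c≡c → proper _ _ x~y
    (≡.trans (≡.sym (toℕ-fromℕ< _)) (≡.trans (≡.cong toℕ c≡c) (toℕ-fromℕ< _)))
    where open Colouring C

  deg : Subset n → Fin n → ℕ
  deg S x = ∣ S ∩ N x ∣

  MaxDegreeIn : Subset n → Fin n → Set
  MaxDegreeIn S v = v ∈ S × (∀ {x} → x ∈ S → deg S x ≤ deg S v)

  max-degree : ∀ S → Nonempty S → ∃[ v ] MaxDegreeIn S v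
  max-degree S (x₀ , x₀∈S) =
    best , argmax-all (deg S) x₀∈S (all-filter (_∈? S) (allFin n)) ,
    λ x∈S → All.lookup (f[xs]≤f[argmax] x₀ vs) (∈-filter⁺ (_∈? S) (∈-allFin _) x∈S)
    where
    vs : List (Fin n)
    vs = filter (_∈? S) (allFin n)
    best : Fin n
    best = argmax (deg S) x₀ vs

  -- If N(v) ∩ S were contained in N(x) ∩ S, the neighbour y of x would make deg S x > deg S v.
  private-neighbour : MaxDegreeIn S v → x ∈ S → y ∈ S → x ~ y → v ≁ y →
                      ∃[ u ] u ∈ S × v ~ u × u ≁ x
  private-neighbour {S} {v} {x} {y} (_ , maximal) x∈S y∈S x~y v≁y
    with any? (λ u → u ∈? S ∩ N v ×-dec ¬? (u ∈? N x))
  ... | yes (u , u∈S∩Nv , u∉Nx) =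
    u , proj₁ (x∈p∩q⁻ S (N v) u∈S∩Nv) , ∈N⁻ (proj₂ (x∈p∩q⁻ S (N v) u∈S∩Nv)) ,
    ≁-sym (∉N⇒≁ u∉Nx)
  ... | no none = ⊥-elim (<⇒≱ (p⊂q⇒∣p∣<∣q∣ (Nv⊆Nx , y , y∈S∩Nx , y∉S∩Nv)) (maximal x∈S))
    where
    Nv⊆Nx : S ∩ N v ⊆ S ∩ N x
    Nv⊆Nx {u} u∈S∩Nv = x∈p∩q⁺ (proj₁ (x∈p∩q⁻ S (N v) u∈S∩Nv) ,
      decidable-stable (u ∈? N x) (λ u∉Nx → none (u , u∈S∩Nv , u∉Nx)))
    y∈S∩Nx : y ∈ S ∩ N x
    y∈S∩Nx = x∈p∩q⁺ (y∈S , ∈N⁺ x~y)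
    y∉S∩Nv : y ∉ S ∩ N v
    y∉S∩Nv y∈S∩Nv = ≁⇒¬~ v≁y (∈N⁻ (proj₂ (x∈p∩q⁻ S (N v) y∈S∩Nv)))

  module _ (2K2-free : Free twoK2 G) where

    no-2K2 : p ~ q → r ~ s → p ≁ r → p ≁ s → q ≁ r → q ≁ s → ⊥
    no-2K2 {p} {q} {r} {s} pq rs pr ps qr qs =
      2K2-free (induced-copy {H = twoK2} {G = G} f twoK2-point-determining upper)
      where
      f : Fin 4 → Fin n
      f = lookup (p ∷ q ∷ r ∷ s ∷ [])
      upper : ∀ {i j} → i Fin.< j → adj G (f i) (f j) ≡ adj twoK2 i j
      upper {zero}             {suc zero}               _ = pq
      upper {zero}             {suc (suc zero)}         _ = pr
      upper {zero}             {suc (suc (suc zero))}   _ = ps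
      upper {suc zero}         {suc (suc zero)}         _ = qr
      upper {suc zero}         {suc (suc (suc zero))}   _ = qs
      upper {suc (suc zero)}   {suc (suc (suc zero))}   _ = rs
      upper {suc zero}         {suc zero}               (s≤s ())
      upper {suc (suc _)}      {suc zero}               (s≤s ())
      upper {suc (suc _)}      {suc (suc zero)}         (s≤s (s≤s ()))
      upper {suc (suc (suc _))} {suc (suc (suc zero))}  (s≤s (s≤s (s≤s ())))

    sees-edge : v ~ u → x ~ y → v ≁ x → v ≁ y → u ≁ x → u ~ y
    sees-edge {v} {u} {x} {y} v~u x~y v≁x v≁y u≁x with ~-or-≁ u y
    ... | inj₁ u~y = u~y
    ... | inj₂ u≁y = ⊥-elim (no-2K2 v~u x~y v≁x v≁y u≁x u≁y)

    non-neighbours-independent : P4FreeOn (_∈ S) → MaxDegreeIn S v →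
                                 x ∈ S → y ∈ S → v ≁ x → v ≁ y → ¬ x ~ y
    non-neighbours-independent p4-free v-max x∈S y∈S v≁x v≁y x~y
      with private-neighbour v-max x∈S y∈S x~y v≁y
    ... | u , u∈S , v~u , u≁x =
      p4-free (proj₁ v-max) u∈S y∈S x∈S
        (induced-P4 v~u (sees-edge v~u x~y v≁x v≁y u≁x) (~-sym x~y) v≁y v≁x u≁x)

    P4-free-colouring : ∀ k S → P4FreeOn (_∈ S) → ¬ CliqueIn (_∈ S) (suc k) → Colouring (_∈ S) k
    P4-free-colouring zero    S _       no-clique =
      empty-colouring (no-clique ∘ clique-singleton {P = _∈ S})
    P4-free-colouring (suc k) S p4-free no-clique with nonempty? S
    ... | no  empty = empty-colouring λ {x} x∈S → empty (x , x∈S)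
    ... | yes nonempty with max-degree S nonempty
    ...   | v , v-max = colouring-mono (≤-reflexive (+-comm k 1))
      (colouring-∪ (_∈? S ∩ N v) neighbours-colouring non-neighbours-colouring cover)
      where
      ∩⁻ : ∀ {x} → x ∈ S ∩ N v → x ∈ S × v ~ x
      ∩⁻ x∈S∩Nv with x∈p∩q⁻ S (N v) x∈S∩Nv
      ... | x∈S , x∈Nv = x∈S , ∈N⁻ x∈Nv
      neighbours-colouring : Colouring (_∈ S ∩ N v) k
      neighbours-colouring = P4-free-colouring k (S ∩ N v)
        (λ ∈a ∈b ∈c ∈d →
          p4-free (proj₁ (∩⁻ ∈a)) (proj₁ (∩⁻ ∈b)) (proj₁ (∩⁻ ∈c)) (proj₁ (∩⁻ ∈d)))
        (no-clique ∘ clique-cons (proj₁ v-max) ∩⁻)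
      non-neighbours-colouring : Colouring (λ x → x ∈ S × v ≁ x) 1
      non-neighbours-colouring = independent-colouring λ (x∈S , v≁x) (y∈S , v≁y) →
        non-neighbours-independent p4-free v-max x∈S y∈S v≁x v≁y
      cover : ∀ {x} → x ∈ S → x ∉ S ∩ N v → x ∈ S × v ≁ x
      cover x∈S x∉S∩Nv = x∈S , ∉N⇒≁ (λ x∈Nv → x∉S∩Nv (x∈p∩q⁺ (x∈S , x∈Nv)))

    -- Fix an edge ab of M and colour x by whether x and b have a common neighbour in M:
    -- adjacent vertices of the same colour would close an induced C5 through b, or form a
    -- 2K2 with ab.
    two-colouring : ∀ {M} → Decidable M → TriangleFreeOn M → C5FreeOn M → Colouring M 2
    two-colouring {M} M? triangle-free C5-free
      with any? (λ a → any? λ b → M? a ×-dec M? b ×-dec adj G a b Bool.≟ true)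
    ... | no no-edge = independent-colouring λ {x} {y} mx my x~y → no-edge (x , y , mx , my , x~y)
    ... | yes (a , b , ma , mb , a~b) =
      record { colour = colour ; colour<k = colour<2 ; proper = proper }
      where
      CommonNeighbour : Fin n → Set
      CommonNeighbour x = ∃[ q ] M q × b ~ q × x ~ q
      common? : ∀ x → Dec (CommonNeighbour x)
      common? x = any? λ q → M? q ×-dec adj G b q Bool.≟ true ×-dec adj G x q Bool.≟ true
      colour : Fin n → ℕ
      colour x with common? x
      ... | yes _ = 1
      ... | no  _ = 0
      colour<2 : ∀ {x} → M x → colour x < 2
      colour<2 {x} _ with common? x
      ... | yes _ = s≤s (s≤s z≤n)
      ... | no  _ = s≤s z≤n
      apart : ∀ {x y z} → M x → M y → M z → x ~ z → y ~ z → x ≁ y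
      apart mx my mz x~z y~z = ¬~⇒≁ λ x~y → triangle-free mx my mz x~y y~z x~z
      proper : ∀ {x y} → M x → M y → x ~ y → colour x ≢ colour y
      proper {x} {y} mx my x~y with common? x | common? y
      ... | yes (q , mq , b~q , x~q) | yes (q′ , mq′ , b~q′ , y~q′) = λ _ →
        C5-free mx my mq′ mb mq record
          { e01 = x~y ; e12 = y~q′ ; e23 = ~-sym b~q′ ; e34 = b~q ; e40 = ~-sym x~q
          ; n02 = apart mx mq′ my x~y (~-sym y~q′)
          ; n03 = apart mx mb mq x~q b~q
          ; n13 = apart my mb mq′ y~q′ b~q′
          ; n14 = apart my mq mx (~-sym x~y) (~-sym x~q)
          ; n24 = apart mq′ mq mb (~-sym b~q′) (~-sym b~q) }
      ... | yes _ | no  _ = λ ()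
      ... | no  _ | yes _ = λ ()
      ... | no  ¬cx | no ¬cy = λ _ → no-2K2 x~y a~b x≁a x≁b y≁a y≁b
        where
        x≁a : x ≁ a
        x≁a = ¬~⇒≁ λ x~a → ¬cx (a , ma , ~-sym a~b , x~a)
        y≁a : y ≁ a
        y≁a = ¬~⇒≁ λ y~a → ¬cy (a , ma , ~-sym a~b , y~a)
        x≁b : x ≁ b
        x≁b = ¬~⇒≁ λ x~b → ¬cy (x , mx , ~-sym x~b , ~-sym x~y)
        y≁b : y ≁ b
        y≁b = ¬~⇒≁ λ y~b → ¬cx (y , my , ~-sym y~b , x~y)

    module _ (K1+P4-free : Free K1+P4 G) where

      no-K1+P4 : h ~ a → h ~ b → h ~ c → h ~ d → InducedP4 a b c d → ⊥
      no-K1+P4 {h} {a} {b} {c} {d} ha hb hc hd (induced-P4 ab bc cd ac ad bd) =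
        K1+P4-free (induced-copy {H = K1+P4} {G = G} f K1+P4-point-determining upper)
        where
        f : Fin 5 → Fin n
        f = lookup (h ∷ a ∷ b ∷ c ∷ d ∷ [])
        upper : ∀ {i j} → i Fin.< j → adj G (f i) (f j) ≡ adj K1+P4 i j
        upper {zero}                   {suc zero}                     _ = ha
        upper {zero}                   {suc (suc zero)}               _ = hb
        upper {zero}                   {suc (suc (suc zero))}         _ = hc
        upper {zero}                   {suc (suc (suc (suc zero)))}   _ = hd
        upper {suc zero}               {suc (suc zero)}               _ = ab
        upper {suc zero}               {suc (suc (suc zero))}         _ = ac
        upper {suc zero}               {suc (suc (suc (suc zero)))}   _ = ad
        upper {suc (suc zero)}         {suc (suc (suc zero))}         _ = bc
        upper {suc (suc zero)}         {suc (suc (suc (suc zero)))}   _ = bd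
        upper {suc (suc (suc zero))}   {suc (suc (suc (suc zero)))}   _ = cd
        upper {suc zero}               {suc zero}                     (s≤s ())
        upper {suc (suc zero)}         {suc zero}                     (s≤s ())
        upper {suc (suc zero)}         {suc (suc zero)}               (s≤s (s≤s ()))
        upper {suc (suc (suc _))}      {suc zero}                     (s≤s ())
        upper {suc (suc (suc _))}      {suc (suc zero)}               (s≤s (s≤s ()))
        upper {suc (suc (suc _))}      {suc (suc (suc zero))}         (s≤s (s≤s (s≤s ())))
        upper {suc (suc (suc (suc _)))} {suc (suc (suc (suc zero)))}  (s≤s (s≤s (s≤s (s≤s ()))))

      neighbourhood-P4-free : P4FreeOn (_∈ N h)
      neighbourhood-P4-free a∈Nh b∈Nh c∈Nh d∈Nh =
        no-K1+P4 (∈N⁻ a∈Nh) (∈N⁻ b∈Nh) (∈N⁻ c∈Nh) (∈N⁻ d∈Nh)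

      no-split-P3 : x ~ y → y ~ z → x ≁ z → u ~ x → u ~ y → u ≁ z → w ~ y → w ~ z → w ≁ x → ⊥
      no-split-P3 {u = u} {w = w} x~y y~z x≁z u~x u~y u≁z w~y w~z w≁x with ~-or-≁ u w
      ... | inj₁ u~w = no-K1+P4 (~-sym x~y) (~-sym u~y) (~-sym w~y) y~z
                         (induced-P4 (~-sym u~x) u~w w~z (≁-sym w≁x) x≁z u≁z)
      ... | inj₂ u≁w = no-2K2 (~-sym u~x) w~z (≁-sym w≁x) x≁z u≁w u≁z

      module _ {v} (v-max : MaxDegreeIn ⊤ v) where

        non-neighbours-triangle-free : TriangleFreeOn (v ≁_)
        non-neighbours-triangle-free {a} {b} {c} v≁a v≁b v≁c a~b b~c a~c
          with private-neighbour v-max ∈⊤ ∈⊤ a~b v≁b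
             | private-neighbour v-max ∈⊤ ∈⊤ (~-sym a~b) v≁a
        ... | ua , _ , v~ua , ua≁a | ub , _ , v~ub , ub≁b = by-cases (~-or-≁ ua ub)
          where
          ua~b : ua ~ b
          ua~b = sees-edge v~ua a~b v≁a v≁b ua≁a
          ua~c : ua ~ c
          ua~c = sees-edge v~ua a~c v≁a v≁c ua≁a
          ub~a : ub ~ a
          ub~a = sees-edge v~ub (~-sym a~b) v≁b v≁a ub≁b
          ub~c : ub ~ c
          ub~c = sees-edge v~ub b~c v≁b v≁c ub≁b
          by-cases : ua ~ ub ⊎ ua ≁ ub → ⊥
          by-cases (inj₁ ua~ub) = no-K1+P4 (~-sym v~ua) ua~ub ua~c ua~b
            (induced-P4 v~ub ub~c (~-sym b~c) v≁c v≁b ub≁b)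
          by-cases (inj₂ ua≁ub) = no-K1+P4 (~-sym ua~c) (~-sym b~c) (~-sym a~c) (~-sym ub~c)
            (induced-P4 ua~b (~-sym a~b) (~-sym ub~a) ua≁a ua≁ub (≁-sym ub≁b))

        attached-edge : InducedC5 c0 c1 c2 c3 c4 →
                        v ≁ c0 → v ≁ c1 → v ≁ c2 → v ≁ c3 → v ≁ c4 → v ~ u → u ≁ c0 →
                        (u ~ c1 × u ~ c2 × u ≁ c3) ⊎ (u ~ c4 × u ~ c3 × u ≁ c2)
        attached-edge {c1 = c1} {c2 = c2} {c3 = c3} {c4 = c4} {u = u}
                      C v≁c0 v≁c1 v≁c2 v≁c3 v≁c4 v~u u≁c0 =
          classify (~-or-≁ u c2) (~-or-≁ u c3)
          where
          open InducedC5 C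
          u~c1 : u ~ c1
          u~c1 = sees-edge v~u e01 v≁c0 v≁c1 u≁c0
          u~c4 : u ~ c4
          u~c4 = sees-edge v~u (~-sym e40) v≁c0 v≁c4 u≁c0
          classify : u ~ c2 ⊎ u ≁ c2 → u ~ c3 ⊎ u ≁ c3 →
                     (u ~ c1 × u ~ c2 × u ≁ c3) ⊎ (u ~ c4 × u ~ c3 × u ≁ c2)
          classify (inj₁ u~c2) (inj₁ u~c3) =
            ⊥-elim (no-K1+P4 u~c1 u~c2 u~c3 u~c4 (induced-P4 e12 e23 e34 n13 n14 n24))
          classify (inj₁ u~c2) (inj₂ u≁c3) = inj₁ (u~c1 , u~c2 , u≁c3)
          classify (inj₂ u≁c2) (inj₁ u~c3) = inj₂ (u~c4 , u~c3 , u≁c2)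
          classify (inj₂ u≁c2) (inj₂ u≁c3) = ⊥-elim (no-2K2 v~u e23 v≁c2 v≁c3 u≁c2 u≁c3)

        non-neighbours-C5-free : C5FreeOn (v ≁_)
        non-neighbours-C5-free v≁c0 v≁c1 v≁c2 v≁c3 v≁c4
                               C@(induced-C5 e01 e12 e23 e34 e40 n02 n03 n13 n14 n24)
          with private-neighbour v-max ∈⊤ ∈⊤ e01 v≁c1
             | private-neighbour v-max ∈⊤ ∈⊤ e12 v≁c2
             | private-neighbour v-max ∈⊤ ∈⊤ e23 v≁c3
        ... | u0 , _ , v~u0 , u0≁c0 | u1 , _ , v~u1 , u1≁c1 | u2 , _ , v~u2 , u2≁c2
          with attached-edge C v≁c0 v≁c1 v≁c2 v≁c3 v≁c4 v~u0 u0≁c0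
             | attached-edge (rotate C) v≁c1 v≁c2 v≁c3 v≁c4 v≁c0 v~u1 u1≁c1
             | attached-edge (rotate (rotate C)) v≁c2 v≁c3 v≁c4 v≁c0 v≁c1 v~u2 u2≁c2
        ... | inj₁ (u0~c1 , u0~c2 , u0≁c3) | inj₁ (u1~c2 , u1~c3 , _) | _ =
          no-split-P3 e12 e23 n13 u0~c1 u0~c2 u0≁c3 u1~c2 u1~c3 u1≁c1
        ... | inj₂ (u0~c4 , u0~c3 , u0≁c2) | inj₁ (u1~c2 , u1~c3 , u1≁c4) | _ =
          no-split-P3 (~-sym e34) (~-sym e23) (≁-sym n24) u0~c4 u0~c3 u0≁c2 u1~c3 u1~c2 u1≁c4
        ... | inj₂ (u0~c4 , u0~c3 , _) | inj₂ (u1~c0 , u1~c4 , u1≁c3) | _ =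
          no-split-P3 e34 e40 (≁-sym n03) u0~c3 u0~c4 u0≁c0 u1~c4 u1~c0 u1≁c3
        ... | inj₁ _ | inj₂ (u1~c0 , u1~c4 , u1≁c3) | inj₁ (u2~c3 , u2~c4 , u2≁c0) =
          no-split-P3 e34 e40 (≁-sym n03) u2~c3 u2~c4 u2≁c0 u1~c4 u1~c0 u1≁c3
        ... | inj₁ (u0~c1 , u0~c2 , _) | inj₂ _ | inj₂ (u2~c1 , u2~c0 , _) =
          no-split-P3 (~-sym e12) (~-sym e01) (≁-sym n02) u0~c2 u0~c1 u0≁c0 u2~c1 u2~c0 u2≁c2

      χ≤ω+2 : ∀ w → IsCliqueNumber G w → Colourable G (w + 2)
      χ≤ω+2 w (_ , no-clique) with nonempty? ⊤
      ... | no  empty = colourable (empty-colouring λ {x} _ → empty (x , ∈⊤))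
      ... | yes nonempty with max-degree ⊤ nonempty
      ...   | v , v-max = colourable
        (colouring-∪ (_∈? N v) neighbours-colouring non-neighbours-colouring cover)
        where
        neighbours-colouring : Colouring (_∈ N v) w
        neighbours-colouring =
          P4-free-colouring w (N v) neighbourhood-P4-free (no-clique ∘ clique {P = _∈ N v})
        non-neighbours-colouring : Colouring (v ≁_) 2
        non-neighbours-colouring = two-colouring (λ x → adj G v x Bool.≟ false)
          (non-neighbours-triangle-free v-max) (non-neighbours-C5-free v-max)
        cover : ∀ {x} → U x → x ∉ N v → v ≁ x
        cover _ = ∉N⇒≁

corollary3p2 : ∀ (n : ℕ) (G : Graph n) (w : ℕ) →
    Free twoK2 G → Free K1+P4 G → IsCliqueNumber G w →
    Colourable G (w + 2)
corollary3p2 n G w 2K2-free K1+P4-free = χ≤ω+2 G 2K2-free K1+P4-free w
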